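{- Let $\mathbb{F}$ be a finite field with $n=|\mathbb{F}|$ elements and $R=M_2(\mathbb{F})$. Then in the graph $G_{Id}(R)$, $\deg(A)=2n-1$ for each $A\in P_1\cup P_2\cup P_3\cup P_4\cup P_5\cup P_6$.
   Context: For a ring $R$, $G_{Id}(R)$ is the simple graph whose vertices are the nontrivial idempotents of $R$ (idempotents other than $0$ and $1$), with distinct $h,k$ adjacent iff $hk=0$ or $kh=0$. Here $P_1=\{\begin{pmatrix}1&0\\0&0\end{pmatrix}\}$, $P_2=\{\begin{pmatrix}0&0\\0&1\end{pmatrix}\}$, $P_3=\{\begin{pmatrix}0&0\\c&1\end{pmatrix}: c\neq0\}$, $P_4=\{\begin{pmatrix}0&b\\0&1\end{pmatrix}: b\neq0\}$, $P_5=\{\begin{pmatrix}1&0\\c&0\end{pmatrix}: c\neq0\}$, $P_6=\{\begin{pmatrix}1&b\\0&0\end{pmatrix}: b\neq0\}$, with $b,c\in\mathbb{F}$. -}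

module Defs where

open import Level using (Level; _⊔_)
open import Algebra.Bundles using (CommutativeRing)
open import Data.Nat using (ℕ)
open import Data.Fin using (Fin)
open import Data.Product using (Σ; ∃; _×_; _,_)
open import Data.Sum using (_⊎_)
open import Relation.Nullary using (¬_)
open import Relation.Binary.PropositionalEquality using (_≡_)

record FiniteField (c ℓ : Level) : Set (Level.suc (c ⊔ ℓ)) where
  field
    commRing : CommutativeRing c ℓ
  open CommutativeRing commRing public
  field
    0≉1      : ¬ (0# ≈ 1#)
    inverse  : ∀ x → ¬ (x ≈ 0#) → ∃ λ y → x * y ≈ 1#
    size     : ℕ
    enum     : Fin size → Carrier
    enum-inj : ∀ i j → enum i ≈ enum j → i ≡ j
    enum-sur : ∀ x → ∃ λ i → enum i ≈ x

module Matrices {c ℓ : Level} (F : FiniteField c ℓ) where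
  open FiniteField F

  record M₂ : Set c where
    constructor mat
    field
      m11 m12 m21 m22 : Carrier
  open M₂ public

  _≈M_ : M₂ → M₂ → Set ℓ
  A ≈M B = (m11 A ≈ m11 B) × (m12 A ≈ m12 B) × (m21 A ≈ m21 B) × (m22 A ≈ m22 B)

  _·_ : M₂ → M₂ → M₂
  A · B = mat (m11 A * m11 B + m12 A * m21 B) (m11 A * m12 B + m12 A * m22 B)
              (m21 A * m11 B + m22 A * m21 B) (m21 A * m12 B + m22 A * m22 B)

  𝟎 𝟏 : M₂
  𝟎 = mat 0# 0# 0# 0#
  𝟏 = mat 1# 0# 0# 1#

  NontrivialIdempotent : M₂ → Set ℓ
  NontrivialIdempotent e = ((e · e) ≈M e) × ¬ (e ≈M 𝟎) × ¬ (e ≈M 𝟏)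

  Adjacent : M₂ → M₂ → Set ℓ
  Adjacent h k = ¬ (h ≈M k) × (((h · k) ≈M 𝟎) ⊎ ((k · h) ≈M 𝟎))

  Neighbour : M₂ → Set (c ⊔ ℓ)
  Neighbour A = Σ M₂ λ B → NontrivialIdempotent B × Adjacent A B

  HasDegree : M₂ → ℕ → Set (c ⊔ ℓ)
  HasDegree A d = Σ (Fin d → Neighbour A) λ f →
      (∀ i j → (Σ.proj₁ (f i) ≈M Σ.proj₁ (f j)) → i ≡ j)
    × (∀ (B : Neighbour A) → ∃ λ i → Σ.proj₁ (f i) ≈M Σ.proj₁ B)

  InP₁ InP₂ InP₃ InP₄ InP₅ InP₆ : M₂ → Set (c ⊔ ℓ)
  InP₁ A = Level.Lift c (A ≈M mat 1# 0# 0# 0#)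
  InP₂ A = Level.Lift c (A ≈M mat 0# 0# 0# 1#)
  InP₃ A = ∃ λ x → ¬ (x ≈ 0#) × (A ≈M mat 0# 0# x 1#)
  InP₄ A = ∃ λ b → ¬ (b ≈ 0#) × (A ≈M mat 0# b 0# 1#)
  InP₅ A = ∃ λ x → ¬ (x ≈ 0#) × (A ≈M mat 1# 0# x 0#)
  InP₆ A = ∃ λ b → ¬ (b ≈ 0#) × (A ≈M mat 1# b 0# 0#)

  InP : M₂ → Set (c ⊔ ℓ)
  InP A = InP₁ A ⊎ InP₂ A ⊎ InP₃ A ⊎ InP₄ A ⊎ InP₅ A ⊎ InP₆ A

module Submission where

-- Transposition and conjugation by (0 1 ; 1 0) are symmetries of G_Id, and they carry every matrix
-- of P₁ … P₆ to E = (0 0 ; x 1) for some x ∈ 𝔽.  A nontrivial idempotent B with EB = 0 is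
-- (1+xq  q ; −x(1+xq)  −xq) for a unique q, one with BE = 0 is (1 0 ; t 0) for a unique t, and the two
-- families share exactly one matrix (q = 0, t = −x).  Hence deg E = n + n − 1.

open import Defs
open import Algebra.Bundles using (CommutativeRing; RawRing)
import Algebra.Properties.CommutativeSemigroup as CommutativeSemigroupProperties
import Algebra.Properties.Ring as RingProperties
import Algebra.Properties.Semiring.Mult.TCOptimised as SemiringMultiplication
import Algebra.Solver.Ring
open import Algebra.Solver.Ring.AlmostCommutativeRing using (fromCommutativeRing; _-Raw-AlmostCommutative⟶_)
open import Data.Bool using (T)
open import Data.Empty using (⊥-elim)
open import Data.Fin as Fin using (Fin; splitAt; join; punchIn; punchOut)
open import Data.Fin.Properties using (splitAt-join; join-splitAt; punchIn-injective; punchInᵢ≢i; punchIn-punchOut)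
open import Data.Maybe using (Maybe; just; nothing; is-just; to-witness-T)
open import Data.Nat as ℕ using (ℕ; zero; suc)
import Data.Nat.Properties as ℕ
open import Data.Product using (Σ; ∃; _×_; _,_; proj₁; proj₂; swap)
open import Data.Sum as Sum using (_⊎_; inj₁; inj₂)
open import Data.Vec using (Vec; _∷_; []; map; allFin)
open import Data.Vec.N-ary using (N-ary; _$ⁿ_)
open import Function.Definitions using (Congruent; Injective; StrictlySurjective)
open import Level using (0ℓ; _⊔_; lift)
open import Relation.Binary.Bundles using (Setoid)
import Relation.Binary.Construct.On as On
open import Relation.Binary.Definitions using (Decidable)
open import Relation.Binary.PropositionalEquality as ≡ using (_≡_)
open import Relation.Nullary using (¬_; yes; no)
open import Relation.Nullary.Decidable using (map′)

module IntegerCoefficientSolver {c ℓ} (R : CommutativeRing c ℓ) where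
  open CommutativeRing R
  open RingProperties ring using (-0#≈0#; -‿+-comm; ⁻¹-anti-homo‿-; [y-z]x≈yx-zx; x[y-z]≈xy-xz)
  open CommutativeSemigroupProperties +-commutativeSemigroup using (interchange)
  open SemiringMultiplication semiring using (×-homo-+; ×1-homo-*) renaming (_×_ to _×′_)
  open import Relation.Binary.Reasoning.Setoid setoid

  -- An integer is represented by a pair (a , b) standing for a − b.
  ℤ-pairs : RawRing 0ℓ 0ℓ
  ℤ-pairs = record
    { Carrier = ℕ × ℕ
    ; _≈_     = _≡_
    ; _+_     = λ { (a , b) (c , d) → a ℕ.+ c , b ℕ.+ d }
    ; _*_     = λ { (a , b) (c , d) → a ℕ.* c ℕ.+ b ℕ.* d , a ℕ.* d ℕ.+ b ℕ.* c }
    ; -_      = swap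
    ; 0#      = 0 , 0
    ; 1#      = 1 , 0
    }

  -- The first clause makes the constants 0 and 1 evaluate to 0# and 1# on the nose.
  ⟦_⟧ℤ : ℕ × ℕ → Carrier
  ⟦ a , zero  ⟧ℤ = a ×′ 1#
  ⟦ a , suc b ⟧ℤ = a ×′ 1# - suc b ×′ 1#

  private
    x-0#≈x : ∀ x → x - 0# ≈ x
    x-0#≈x x = trans (+-congˡ -0#≈0#) (+-identityʳ x)

    ⟦⟧ℤ-difference : ∀ a b → ⟦ a , b ⟧ℤ ≈ a ×′ 1# - b ×′ 1#
    ⟦⟧ℤ-difference a zero    = sym (x-0#≈x (a ×′ 1#))
    ⟦⟧ℤ-difference a (suc b) = refl

    [u+w]-[v+z]≈[u-v]+[w-z] : ∀ u v w z → (u + w) - (v + z) ≈ (u - v) + (w - z)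
    [u+w]-[v+z]≈[u-v]+[w-z] u v w z = begin
      (u + w) - (v + z)      ≈⟨ +-congˡ (-‿+-comm v z) ⟨
      (u + w) + (- v + - z)  ≈⟨ interchange u w (- v) (- z) ⟩
      (u - v) + (w - z)      ∎

    [uw+vz]-[uz+vw]≈[u-v][w-z] : ∀ u v w z → (u * w + v * z) - (u * z + v * w) ≈ (u - v) * (w - z)
    [uw+vz]-[uz+vw]≈[u-v][w-z] u v w z = begin
      (u * w + v * z) - (u * z + v * w)      ≈⟨ [u+w]-[v+z]≈[u-v]+[w-z] (u * w) (u * z) (v * z) (v * w) ⟩
      (u * w - u * z) + (v * z - v * w)      ≈⟨ +-congˡ (⁻¹-anti-homo‿- (v * w) (v * z)) ⟨
      (u * w - u * z) - (v * w - v * z)      ≈⟨ +-cong (x[y-z]≈xy-xz u w z) (-‿cong (x[y-z]≈xy-xz v w z)) ⟨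
      u * (w - z) - v * (w - z)              ≈⟨ [y-z]x≈yx-zx (w - z) u v ⟨
      (u - v) * (w - z)                      ∎

    [u+t]-[v+t]≈u-v : ∀ u v t → (u + t) - (v + t) ≈ u - v
    [u+t]-[v+t]≈u-v u v t = begin
      (u + t) - (v + t)  ≈⟨ [u+w]-[v+z]≈[u-v]+[w-z] u v t t ⟩
      (u - v) + (t - t)  ≈⟨ +-congˡ (-‿inverseʳ t) ⟩
      (u - v) + 0#       ≈⟨ +-identityʳ (u - v) ⟩
      u - v              ∎

    u+z≈w+v⇒u-v≈w-z : ∀ u v w z → u + z ≈ w + v → u - v ≈ w - z
    u+z≈w+v⇒u-v≈w-z u v w z eq = begin
      u - v              ≈⟨ [u+t]-[v+t]≈u-v u v z ⟨
      (u + z) - (v + z)  ≈⟨ +-cong eq (-‿cong (+-comm v z)) ⟩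
      (w + v) - (z + v)  ≈⟨ [u+t]-[v+t]≈u-v w z v ⟩
      w - z              ∎

    ⟦⟧ℤ-homomorphism : ℤ-pairs -Raw-AlmostCommutative⟶ fromCommutativeRing R
    ⟦⟧ℤ-homomorphism = record
      { ⟦_⟧    = ⟦_⟧ℤ
      ; +-homo = λ { (a , b) (c , d) → begin
          ⟦ a ℕ.+ c , b ℕ.+ d ⟧ℤ                          ≈⟨ ⟦⟧ℤ-difference (a ℕ.+ c) (b ℕ.+ d) ⟩
          (a ℕ.+ c) ×′ 1# - (b ℕ.+ d) ×′ 1#               ≈⟨ +-cong (×-homo-+ 1# a c) (-‿cong (×-homo-+ 1# b d)) ⟩
          (a ×′ 1# + c ×′ 1#) - (b ×′ 1# + d ×′ 1#)       ≈⟨ [u+w]-[v+z]≈[u-v]+[w-z] _ _ _ _ ⟩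
          (a ×′ 1# - b ×′ 1#) + (c ×′ 1# - d ×′ 1#)       ≈⟨ +-cong (⟦⟧ℤ-difference a b) (⟦⟧ℤ-difference c d) ⟨
          ⟦ a , b ⟧ℤ + ⟦ c , d ⟧ℤ                          ∎ }
      ; *-homo = λ { (a , b) (c , d) → begin
          ⟦ a ℕ.* c ℕ.+ b ℕ.* d , a ℕ.* d ℕ.+ b ℕ.* c ⟧ℤ
            ≈⟨ ⟦⟧ℤ-difference (a ℕ.* c ℕ.+ b ℕ.* d) (a ℕ.* d ℕ.+ b ℕ.* c) ⟩
          (a ℕ.* c ℕ.+ b ℕ.* d) ×′ 1# - (a ℕ.* d ℕ.+ b ℕ.* c) ×′ 1#
            ≈⟨ +-cong (trans (×-homo-+ 1# (a ℕ.* c) (b ℕ.* d)) (+-cong (×1-homo-* a c) (×1-homo-* b d)))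
                      (-‿cong (trans (×-homo-+ 1# (a ℕ.* d) (b ℕ.* c)) (+-cong (×1-homo-* a d) (×1-homo-* b c)))) ⟩
          (a ×′ 1# * c ×′ 1# + b ×′ 1# * d ×′ 1#) - (a ×′ 1# * d ×′ 1# + b ×′ 1# * c ×′ 1#)
            ≈⟨ [uw+vz]-[uz+vw]≈[u-v][w-z] _ _ _ _ ⟩
          (a ×′ 1# - b ×′ 1#) * (c ×′ 1# - d ×′ 1#)
            ≈⟨ *-cong (⟦⟧ℤ-difference a b) (⟦⟧ℤ-difference c d) ⟨
          ⟦ a , b ⟧ℤ * ⟦ c , d ⟧ℤ ∎ }
      ; -‿homo = λ { (a , b) → begin
          ⟦ b , a ⟧ℤ                 ≈⟨ ⟦⟧ℤ-difference b a ⟩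
          b ×′ 1# - a ×′ 1#          ≈⟨ ⁻¹-anti-homo‿- _ _ ⟨
          - (a ×′ 1# - b ×′ 1#)      ≈⟨ -‿cong (⟦⟧ℤ-difference a b) ⟨
          - ⟦ a , b ⟧ℤ               ∎ }
      ; 0-homo = refl
      ; 1-homo = refl
      }

    ⟦⟧ℤ-equal? : ∀ p q → Maybe (⟦ p ⟧ℤ ≈ ⟦ q ⟧ℤ)
    ⟦⟧ℤ-equal? (a , b) (c , d) with a ℕ.+ d ℕ.≟ c ℕ.+ b
    ... | no _   = nothing
    ... | yes eq = just (begin
      ⟦ a , b ⟧ℤ         ≈⟨ ⟦⟧ℤ-difference a b ⟩
      a ×′ 1# - b ×′ 1#  ≈⟨ u+z≈w+v⇒u-v≈w-z _ _ _ _ (begin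
        a ×′ 1# + d ×′ 1#  ≈⟨ ×-homo-+ 1# a d ⟨
        (a ℕ.+ d) ×′ 1#    ≡⟨ ≡.cong (_×′ 1#) eq ⟩
        (c ℕ.+ b) ×′ 1#    ≈⟨ ×-homo-+ 1# c b ⟩
        c ×′ 1# + b ×′ 1#  ∎) ⟩
      c ×′ 1# - d ×′ 1#  ≈⟨ ⟦⟧ℤ-difference c d ⟨
      ⟦ c , d ⟧ℤ         ∎)

  private
    module Solver = Algebra.Solver.Ring ℤ-pairs (fromCommutativeRing R) ⟦⟧ℤ-homomorphism ⟦⟧ℤ-equal?
  open Solver public using (Polynomial; _:+_; _:*_; :-_; _:-_; _:=_; ⟦_⟧)
  open Solver using (con; var; normalise; _≟N_; ⟦_⟧N-cong; prove)

  O I : ∀ {n} → Polynomial n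
  O = con (0 , 0)
  I = con (1 , 0)

  close : ∀ {a} {A : Set a} n → N-ary n (Polynomial n) A → A
  close n f = f $ⁿ map var (allFin n)

  SameNormalForm : ∀ {n} → Polynomial n × Polynomial n → Set
  SameNormalForm (p , q) = T (is-just (normalise p ≟N normalise q))

  -- Unlike the library's prove, the normal forms are compared with the coefficient test
  -- rather than up to definitional equality; for closed polynomials the check is discharged by `_`.
  same-normal-form⇒≈ : ∀ {n} (p q : Polynomial n) → SameNormalForm (p , q) → ∀ ρ → ⟦ p ⟧ ρ ≈ ⟦ q ⟧ ρ
  same-normal-form⇒≈ p q same ρ = prove ρ p q (⟦ to-witness-T (normalise p ≟N normalise q) same ⟧N-cong ρ)

  solve : ∀ n (f : N-ary n (Polynomial n) (Polynomial n × Polynomial n)) → SameNormalForm (close n f) →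
          ∀ ρ → ⟦ proj₁ (close n f) ⟧ ρ ≈ ⟦ proj₂ (close n f) ⟧ ρ
  solve n f = same-normal-form⇒≈ (proj₁ (close n f)) (proj₂ (close n f))

module _ {a ℓ} (S : Setoid a ℓ) where
  open Setoid S

  Enumeration : ℕ → Set (a ⊔ ℓ)
  Enumeration d = Σ (Fin d → Carrier) λ f → (∀ i j → f i ≈ f j → i ≡ j) × StrictlySurjective _≈_ f

  enumeration-≟ : ∀ {d} → Enumeration d → Decidable _≈_
  enumeration-≟ (f , f-injective , f-surjective) x y =
    map′ (λ i≡j → trans (sym fi≈x) (trans (reflexive (≡.cong f i≡j)) fj≈y))
         (λ x≈y → f-injective i j (trans fi≈x (trans x≈y (sym fj≈y))))
         (i Fin.≟ j)
    where
    i = proj₁ (f-surjective x)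
    j = proj₁ (f-surjective y)
    fi≈x = proj₂ (f-surjective x)
    fj≈y = proj₂ (f-surjective y)

  enumeration-⊎ : ∀ {m n} (g : Fin m ⊎ Fin n → Carrier) → (∀ u v → g u ≈ g v → u ≡ v) → StrictlySurjective _≈_ g →
                  Enumeration (m ℕ.+ n)
  enumeration-⊎ {m} {n} g g-injective g-surjective = f , f-injective , f-surjective
    where
    f : Fin (m ℕ.+ n) → Carrier
    f k = g (splitAt m k)
    f-injective : ∀ i j → f i ≈ f j → i ≡ j
    f-injective i j fi≈fj = ≡.trans (≡.sym (join-splitAt m n i))
      (≡.trans (≡.cong (join m n) (g-injective (splitAt m i) (splitAt m j) fi≈fj)) (join-splitAt m n j))
    f-surjective : StrictlySurjective _≈_ f
    f-surjective y with g-surjective y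
    ... | u , gu≈y = join m n u , ≡.subst (λ v → g v ≈ y) (≡.sym (splitAt-join m n u)) gu≈y

module _ {a b ℓ₁ ℓ₂} {S : Setoid a ℓ₁} {T : Setoid b ℓ₂} where
  private
    module S = Setoid S
    module T = Setoid T

  enumeration-map : ∀ {d} (h : S.Carrier → T.Carrier) → Congruent S._≈_ T._≈_ h → Injective S._≈_ T._≈_ h →
                    StrictlySurjective T._≈_ h → Enumeration S d → Enumeration T d
  enumeration-map h h-cong h-injective h-surjective (f , f-injective , f-surjective) =
    (λ i → h (f i)) ,
    (λ i j hfi≈hfj → f-injective i j (h-injective hfi≈hfj)) ,
    λ y → let (x , hx≈y) = h-surjective y ; (i , fi≈x) = f-surjective x in i , T.trans (h-cong fi≈x) hx≈y

  module UnionOfTwoCopies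
    (X Y : S.Carrier → T.Carrier)
    (X-cong : Congruent S._≈_ T._≈_ X) (Y-cong : Congruent S._≈_ T._≈_ Y)
    (X-injective : Injective S._≈_ T._≈_ X) (Y-injective : Injective S._≈_ T._≈_ Y)
    (s₀ t₀ : S.Carrier) (meet : Y t₀ T.≈ X s₀) (meet-only : ∀ {s t} → X s T.≈ Y t → t S.≈ t₀)
    (cover : ∀ z → (∃ λ s → X s T.≈ z) ⊎ (∃ λ t → Y t T.≈ z))
    where

    enumeration-∪ : ∀ {n} → Enumeration S n → Enumeration T (2 ℕ.* n ℕ.∸ 1)
    enumeration-∪ {zero} (_ , _ , e-surjective) with e-surjective t₀
    ... | () , _
    enumeration-∪ {suc m} (e , e-injective , e-surjective) =
      ≡.subst (Enumeration T) [1+m]+m≡2*[1+m]∸1 (enumeration-⊎ T g g-injective g-surjective)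
      where
      index : S.Carrier → Fin (suc m)
      index s = proj₁ (e-surjective s)
      e-index : ∀ s → e (index s) S.≈ s
      e-index s = proj₂ (e-surjective s)

      i₀ = index t₀

      -- Y is only used away from the index of t₀, so that the copies are disjoint.
      g : Fin (suc m) ⊎ Fin m → T.Carrier
      g (inj₁ i) = X (e i)
      g (inj₂ j) = Y (e (punchIn i₀ j))

      X≉Y : ∀ i j → ¬ X (e i) T.≈ Y (e (punchIn i₀ j))
      X≉Y i j Xeᵢ≈Ye = punchInᵢ≢i i₀ j (e-injective _ _ (S.trans (meet-only Xeᵢ≈Ye) (S.sym (e-index t₀))))

      g-injective : ∀ u v → g u T.≈ g v → u ≡ v
      g-injective (inj₁ i) (inj₁ i′) gu≈gv = ≡.cong inj₁ (e-injective i i′ (X-injective gu≈gv))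
      g-injective (inj₁ i) (inj₂ j)  gu≈gv = ⊥-elim (X≉Y i j gu≈gv)
      g-injective (inj₂ j) (inj₁ i)  gu≈gv = ⊥-elim (X≉Y i j (T.sym gu≈gv))
      g-injective (inj₂ j) (inj₂ j′) gu≈gv = ≡.cong inj₂ (punchIn-injective i₀ j j′ (e-injective _ _ (Y-injective gu≈gv)))

      from-X : ∀ {s z} → X s T.≈ z → ∃ λ u → g u T.≈ z
      from-X {s} Xs≈z = inj₁ (index s) , T.trans (X-cong (e-index s)) Xs≈z

      from-Y : ∀ {t z} → Y t T.≈ z → ∃ λ u → g u T.≈ z
      from-Y {t} Yt≈z with i₀ Fin.≟ index t
      ... | yes i₀≡i = from-X (T.trans (T.sym meet) (T.trans (Y-cong t₀≈t) Yt≈z))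
        where t₀≈t = S.trans (S.sym (e-index t₀)) (S.trans (S.reflexive (≡.cong e i₀≡i)) (e-index t))
      ... | no i₀≢i = inj₂ (punchOut i₀≢i) ,
        T.trans (Y-cong (S.trans (S.reflexive (≡.cong e (punchIn-punchOut i₀≢i))) (e-index t))) Yt≈z

      g-surjective : StrictlySurjective T._≈_ g
      g-surjective z with cover z
      ... | inj₁ (_ , Xs≈z) = from-X Xs≈z
      ... | inj₂ (_ , Yt≈z) = from-Y Yt≈z

      [1+m]+m≡2*[1+m]∸1 : suc m ℕ.+ m ≡ 2 ℕ.* suc m ℕ.∸ 1
      [1+m]+m≡2*[1+m]∸1 = ≡.sym (≡.trans (ℕ.+-suc m (m ℕ.+ 0)) (≡.cong (λ k → suc (m ℕ.+ k)) (ℕ.+-identityʳ m)))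

module IdempotentGraph {c ℓ} (F : FiniteField c ℓ) where
  open FiniteField F
  open Matrices F
  open IntegerCoefficientSolver commRing
  open RingProperties ring using (-0#≈0#; +-inverseʳ-unique)
  open import Relation.Binary.Reasoning.Setoid setoid

  _≟_ : Decidable _≈_
  _≟_ = enumeration-≟ setoid (enum , enum-inj , enum-sur)

  x*y≈x⇒x≈0∨y≈1 : ∀ {x y} → x * y ≈ x → x ≈ 0# ⊎ y ≈ 1#
  x*y≈x⇒x≈0∨y≈1 {x} {y} xy≈x with x ≟ 0#
  ... | yes x≈0 = inj₁ x≈0
  ... | no x≉0 = inj₂ (begin
    y            ≈⟨ *-identityˡ y ⟨
    1# * y       ≈⟨ *-congʳ (trans (sym xw≈1) (*-comm x w)) ⟩
    (w * x) * y  ≈⟨ *-assoc w x y ⟩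
    w * (x * y)  ≈⟨ *-congˡ xy≈x ⟩
    w * x        ≈⟨ *-comm w x ⟩
    x * w        ≈⟨ xw≈1 ⟩
    1#           ∎)
    where
    w = proj₁ (inverse x x≉0)
    xw≈1 = proj₂ (inverse x x≉0)

  ≈M-setoid : Setoid c ℓ
  ≈M-setoid = record
    { Carrier       = M₂
    ; _≈_           = _≈M_
    ; isEquivalence = record
      { refl  = refl , refl , refl , refl
      ; sym   = λ (a , b , c , d) → sym a , sym b , sym c , sym d
      ; trans = λ (a , b , c , d) (a′ , b′ , c′ , d′) → trans a a′ , trans b b′ , trans c c′ , trans d d′
      }
    }

  open Setoid ≈M-setoid public using () renaming (refl to ≈M-refl; sym to ≈M-sym; trans to ≈M-trans)

  ·-cong : ∀ {A A′ B B′} → A ≈M A′ → B ≈M B′ → (A · B) ≈M (A′ · B′)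
  ·-cong (a , b , c , d) (a′ , b′ , c′ , d′) =
    +-cong (*-cong a a′) (*-cong b c′) , +-cong (*-cong a b′) (*-cong b d′) ,
    +-cong (*-cong c a′) (*-cong d c′) , +-cong (*-cong c b′) (*-cong d d′)

  record PolyMatrix (n : ℕ) : Set where
    constructor pmat
    field p11 p12 p21 p22 : Polynomial n

  ⟦_⟧M : ∀ {n} → PolyMatrix n → Vec Carrier n → M₂
  ⟦ pmat a b c d ⟧M ρ = mat (⟦ a ⟧ ρ) (⟦ b ⟧ ρ) (⟦ c ⟧ ρ) (⟦ d ⟧ ρ)

  _⊙_ : ∀ {n} → PolyMatrix n → PolyMatrix n → PolyMatrix n
  pmat a b c d ⊙ pmat a′ b′ c′ d′ =
    pmat (a :* a′ :+ b :* c′) (a :* b′ :+ b :* d′) (c :* a′ :+ d :* c′) (c :* b′ :+ d :* d′)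

  SameNormalFormM : ∀ {n} → PolyMatrix n × PolyMatrix n → Set
  SameNormalFormM (pmat a b c d , pmat a′ b′ c′ d′) =
    SameNormalForm (a , a′) × SameNormalForm (b , b′) × SameNormalForm (c , c′) × SameNormalForm (d , d′)

  solveM : ∀ n (f : N-ary n (Polynomial n) (PolyMatrix n × PolyMatrix n)) → SameNormalFormM (close n f) →
           ∀ ρ → ⟦ proj₁ (close n f) ⟧M ρ ≈M ⟦ proj₂ (close n f) ⟧M ρ
  solveM n f = solve-pair (close n f)
    where
    solve-pair : ∀ (PQ : PolyMatrix n × PolyMatrix n) → SameNormalFormM PQ → ∀ ρ → ⟦ proj₁ PQ ⟧M ρ ≈M ⟦ proj₂ PQ ⟧M ρ
    solve-pair (pmat a b c d , pmat a′ b′ c′ d′) (sa , sb , sc , sd) ρ =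
      same-normal-form⇒≈ a a′ sa ρ , same-normal-form⇒≈ b b′ sb ρ ,
      same-normal-form⇒≈ c c′ sc ρ , same-normal-form⇒≈ d d′ sd ρ

  ·-identityʳ : ∀ A → (A · 𝟏) ≈M A
  ·-identityʳ (mat a b c d) = solveM 4 (λ a b c d → pmat a b c d ⊙ pmat I O O I , pmat a b c d) _ (a ∷ b ∷ c ∷ d ∷ [])

  ·-identityˡ : ∀ A → (𝟏 · A) ≈M A
  ·-identityˡ (mat a b c d) = solveM 4 (λ a b c d → pmat I O O I ⊙ pmat a b c d , pmat a b c d) _ (a ∷ b ∷ c ∷ d ∷ [])

  -- HasDegree A d unfolds to Enumeration (neighbour-setoid A) d.
  neighbour-setoid : M₂ → Setoid (c ⊔ ℓ) ℓ
  neighbour-setoid A = On.setoid {B = Neighbour A} ≈M-setoid proj₁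

  Adjacent-respˡ : ∀ {A A′ B} → A ≈M A′ → Adjacent A B → Adjacent A′ B
  Adjacent-respˡ A≈A′ (A≉B , inj₁ AB≈0) =
    (λ A′≈B → A≉B (≈M-trans A≈A′ A′≈B)) , inj₁ (≈M-trans (·-cong (≈M-sym A≈A′) ≈M-refl) AB≈0)
  Adjacent-respˡ A≈A′ (A≉B , inj₂ BA≈0) =
    (λ A′≈B → A≉B (≈M-trans A≈A′ A′≈B)) , inj₂ (≈M-trans (·-cong ≈M-refl (≈M-sym A≈A′)) BA≈0)

  HasDegree-resp : ∀ {A A′ d} → A ≈M A′ → HasDegree A d → HasDegree A′ d
  HasDegree-resp {A} {A′} A≈A′ = enumeration-map {S = neighbour-setoid A} {T = neighbour-setoid A′}
    (λ (B , idempotent , adjacent) → B , idempotent , Adjacent-respˡ A≈A′ adjacent) (λ B≈C → B≈C) (λ B≈C → B≈C)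
    (λ (B , idempotent , adjacent) → (B , idempotent , Adjacent-respˡ (≈M-sym A≈A′) adjacent) , ≈M-refl)

  -- For a nonzero idempotent B, B ≈ A or B ≈ 𝟏 would turn the zero product AB or BA into B or A.
  annihilating-neighbour : ∀ {A B} → ¬ A ≈M 𝟎 → (B · B) ≈M B → ¬ B ≈M 𝟎 →
                           (A · B) ≈M 𝟎 ⊎ (B · A) ≈M 𝟎 → Neighbour A
  annihilating-neighbour {A} {B} A≉0 BB≈B B≉0 zero-product = B , (BB≈B , B≉0 , B≉1) , A≉B , zero-product
    where
    A≉B : ¬ A ≈M B
    A≉B A≈B = B≉0 (≈M-trans (≈M-sym BB≈B) (Sum.[
      (λ AB≈0 → ≈M-trans (·-cong (≈M-sym A≈B) ≈M-refl) AB≈0) ,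
      (λ BA≈0 → ≈M-trans (·-cong ≈M-refl (≈M-sym A≈B)) BA≈0) ] zero-product))
    B≉1 : ¬ B ≈M 𝟏
    B≉1 B≈1 = A≉0 (Sum.[
      (λ AB≈0 → ≈M-trans (≈M-sym (·-identityʳ A)) (≈M-trans (·-cong ≈M-refl (≈M-sym B≈1)) AB≈0)) ,
      (λ BA≈0 → ≈M-trans (≈M-sym (·-identityˡ A)) (≈M-trans (·-cong (≈M-sym B≈1) ≈M-refl) BA≈0)) ] zero-product)

  module Symmetry
    (φ : M₂ → M₂) (φ-cong : Congruent _≈M_ _≈M_ φ) (φ-involutive : ∀ A → φ (φ A) ≈M A)
    (φ-𝟎 : φ 𝟎 ≈M 𝟎) (φ-𝟏 : φ 𝟏 ≈M 𝟏)
    (φ-· : ∀ A B → φ (A · B) ≈M (φ A · φ B) ⊎ φ (A · B) ≈M (φ B · φ A))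
    where

    φ-injective : Injective _≈M_ _≈M_ φ
    φ-injective {A} {B} φA≈φB = ≈M-trans (≈M-sym (φ-involutive A)) (≈M-trans (φ-cong φA≈φB) (φ-involutive B))

    φ-square : ∀ A → (φ A · φ A) ≈M φ (A · A)
    φ-square A = Sum.[ ≈M-sym , ≈M-sym ] (φ-· A A)

    φ-zero-product : ∀ {A B} → (A · B) ≈M 𝟎 → (φ A · φ B) ≈M 𝟎 ⊎ (φ B · φ A) ≈M 𝟎
    φ-zero-product {A} {B} AB≈0 = Sum.map vanishes vanishes (φ-· A B)
      where
      vanishes : ∀ {C} → φ (A · B) ≈M C → C ≈M 𝟎
      vanishes φAB≈C = ≈M-trans (≈M-sym φAB≈C) (≈M-trans (φ-cong AB≈0) φ-𝟎)

    φ-NontrivialIdempotent : ∀ {A} → NontrivialIdempotent A → NontrivialIdempotent (φ A)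
    φ-NontrivialIdempotent {A} (AA≈A , A≉0 , A≉1) =
      ≈M-trans (φ-square A) (φ-cong AA≈A) ,
      (λ φA≈0 → A≉0 (φ-injective (≈M-trans φA≈0 (≈M-sym φ-𝟎)))) ,
      (λ φA≈1 → A≉1 (φ-injective (≈M-trans φA≈1 (≈M-sym φ-𝟏))))

    φ-Adjacent : ∀ {A B} → Adjacent A B → Adjacent (φ A) (φ B)
    φ-Adjacent (A≉B , inj₁ AB≈0) = (λ φA≈φB → A≉B (φ-injective φA≈φB)) , φ-zero-product AB≈0
    φ-Adjacent (A≉B , inj₂ BA≈0) = (λ φA≈φB → A≉B (φ-injective φA≈φB)) , Sum.swap (φ-zero-product BA≈0)

    HasDegree-φ : ∀ {A d} → HasDegree A d → HasDegree (φ A) d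
    HasDegree-φ {A} = enumeration-map {S = neighbour-setoid A} {T = neighbour-setoid (φ A)}
      (λ (B , idempotent , adjacent) → φ B , φ-NontrivialIdempotent idempotent , φ-Adjacent adjacent) φ-cong φ-injective
      (λ (C , idempotent , adjacent) →
        (φ C , φ-NontrivialIdempotent idempotent , Adjacent-respˡ (φ-involutive A) (φ-Adjacent adjacent)) , φ-involutive C)

  transpose : M₂ → M₂
  transpose A = mat (m11 A) (m21 A) (m12 A) (m22 A)

  -- Conjugation by the permutation matrix (0 1 ; 1 0).
  rotate : M₂ → M₂
  rotate A = mat (m22 A) (m21 A) (m12 A) (m11 A)

  transpose-· : ∀ A B → transpose (A · B) ≈M (transpose B · transpose A)
  transpose-· A B = +-cong (*-comm _ _) (*-comm _ _) , +-cong (*-comm _ _) (*-comm _ _) ,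
                    +-cong (*-comm _ _) (*-comm _ _) , +-cong (*-comm _ _) (*-comm _ _)

  rotate-· : ∀ A B → rotate (A · B) ≈M (rotate A · rotate B)
  rotate-· A B = +-comm _ _ , +-comm _ _ , +-comm _ _ , +-comm _ _

  open Symmetry transpose (λ (a , b , c , d) → a , c , b , d) (λ _ → ≈M-refl) ≈M-refl ≈M-refl
    (λ A B → inj₂ (transpose-· A B)) public using () renaming (HasDegree-φ to HasDegree-transpose)

  open Symmetry rotate (λ (a , b , c , d) → d , c , b , a) (λ _ → ≈M-refl) ≈M-refl ≈M-refl
    (λ A B → inj₁ (rotate-· A B)) public using () renaming (HasDegree-φ to HasDegree-rotate)

  lowerIdempotent : Carrier → M₂
  lowerIdempotent x = mat 0# 0# x 1#

  rightAnnihilator : Carrier → Carrier → M₂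
  rightAnnihilator x q = mat (1# + x * q) q (- (x * (1# + x * q))) (- (x * q))

  leftAnnihilator : Carrier → M₂
  leftAnnihilator t = mat 1# 0# t 0#

  lowerIdempotentᴾ : ∀ {n} → Polynomial n → PolyMatrix n
  lowerIdempotentᴾ x = pmat O O x I

  rightAnnihilatorᴾ : ∀ {n} → Polynomial n → Polynomial n → PolyMatrix n
  rightAnnihilatorᴾ x q = pmat (I :+ x :* q) q (:- (x :* (I :+ x :* q))) (:- (x :* q))

  leftAnnihilatorᴾ : ∀ {n} → Polynomial n → PolyMatrix n
  leftAnnihilatorᴾ t = pmat I O t O

  module LowerIdempotent (x : Carrier) where

    lowerIdempotent≉𝟎 : ¬ lowerIdempotent x ≈M 𝟎
    lowerIdempotent≉𝟎 (_ , _ , _ , 1≈0) = 0≉1 (sym 1≈0)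

    -- The trace of rightAnnihilator x q is 1.
    rightAnnihilator≉𝟎 : ∀ q → ¬ rightAnnihilator x q ≈M 𝟎
    rightAnnihilator≉𝟎 q (a≈0 , _ , _ , d≈0) = 0≉1 (begin
      0#                           ≈⟨ +-identityʳ 0# ⟨
      0# + 0#                      ≈⟨ +-cong a≈0 d≈0 ⟨
      (1# + x * q) + - (x * q)     ≈⟨ solve 2 (λ x q → (I :+ x :* q) :- x :* q := I) _ (x ∷ q ∷ []) ⟩
      1#                           ∎)

    leftAnnihilator≉𝟎 : ∀ t → ¬ leftAnnihilator t ≈M 𝟎
    leftAnnihilator≉𝟎 t (1≈0 , _) = 0≉1 (sym 1≈0)

    X : Carrier → Neighbour (lowerIdempotent x)
    X q = annihilating-neighbour lowerIdempotent≉𝟎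
      (solveM 2 (λ x q → rightAnnihilatorᴾ x q ⊙ rightAnnihilatorᴾ x q , rightAnnihilatorᴾ x q) _ (x ∷ q ∷ []))
      (rightAnnihilator≉𝟎 q)
      (inj₁ (solveM 2 (λ x q → lowerIdempotentᴾ x ⊙ rightAnnihilatorᴾ x q , pmat O O O O) _ (x ∷ q ∷ [])))

    Y : Carrier → Neighbour (lowerIdempotent x)
    Y t = annihilating-neighbour lowerIdempotent≉𝟎
      (solveM 1 (λ t → leftAnnihilatorᴾ t ⊙ leftAnnihilatorᴾ t , leftAnnihilatorᴾ t) _ (t ∷ []))
      (leftAnnihilator≉𝟎 t)
      (inj₂ (solveM 2 (λ x t → leftAnnihilatorᴾ t ⊙ lowerIdempotentᴾ x , pmat O O O O) _ (x ∷ t ∷ [])))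

    u≈0⇒-xu≈0 : ∀ {u} → u ≈ 0# → - (x * u) ≈ 0#
    u≈0⇒-xu≈0 u≈0 = trans (-‿cong (trans (*-congˡ u≈0) (zeroʳ x))) -0#≈0#

    u+1*v≈0⇒v≈-u : ∀ u v → u + 1# * v ≈ 0# → v ≈ - u
    u+1*v≈0⇒v≈-u u v u+v≈0 = trans (sym (*-identityˡ v)) (+-inverseʳ-unique u (1# * v) u+v≈0)

    -- With c = -xa and d = -xb, idempotence says a s = a and b s = b for s = a - xb.
    right-annihilated : ∀ {B} → NontrivialIdempotent B → (lowerIdempotent x · B) ≈M 𝟎 →
                        ∃ λ q → rightAnnihilator x q ≈M B
    right-annihilated {mat a b c d} ((aa+bc≈a , ab+bd≈b , _ , _) , B≉0 , _) (_ , _ , xa+c≈0 , xb+d≈0) =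
      conclude (x*y≈x⇒x≈0∨y≈1 as≈a) (x*y≈x⇒x≈0∨y≈1 bs≈b)
      where
      c≈-xa = u+1*v≈0⇒v≈-u (x * a) c xa+c≈0
      d≈-xb = u+1*v≈0⇒v≈-u (x * b) d xb+d≈0
      as≈a : a * (a - x * b) ≈ a
      as≈a = begin
        a * (a - x * b)          ≈⟨ solve 3 (λ x a b → a :* (a :- x :* b) := a :* a :+ b :* (:- (x :* a))) _ (x ∷ a ∷ b ∷ []) ⟩
        a * a + b * - (x * a)    ≈⟨ +-congˡ (*-congˡ c≈-xa) ⟨
        a * a + b * c            ≈⟨ aa+bc≈a ⟩
        a                        ∎
      bs≈b : b * (a - x * b) ≈ b
      bs≈b = begin
        b * (a - x * b)          ≈⟨ solve 3 (λ x a b → b :* (a :- x :* b) := a :* b :+ b :* (:- (x :* b))) _ (x ∷ a ∷ b ∷ []) ⟩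
        a * b + b * - (x * b)    ≈⟨ +-congˡ (*-congˡ d≈-xb) ⟨
        a * b + b * d            ≈⟨ ab+bd≈b ⟩
        b                        ∎
      annihilator : a - x * b ≈ 1# → rightAnnihilator x b ≈M mat a b c d
      annihilator s≈1 = sym a≈1+xb , refl , trans (-‿cong (*-congˡ (sym a≈1+xb))) (sym c≈-xa) , sym d≈-xb
        where
        a≈1+xb = trans (solve 3 (λ x a b → a := (a :- x :* b) :+ x :* b) _ (x ∷ a ∷ b ∷ [])) (+-congʳ s≈1)
      conclude : a ≈ 0# ⊎ a - x * b ≈ 1# → b ≈ 0# ⊎ a - x * b ≈ 1# → ∃ λ q → rightAnnihilator x q ≈M mat a b c d
      conclude (inj₂ s≈1) _          = b , annihilator s≈1
      conclude (inj₁ _)   (inj₂ s≈1) = b , annihilator s≈1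
      conclude (inj₁ a≈0) (inj₁ b≈0) =
        ⊥-elim (B≉0 (a≈0 , b≈0 , trans c≈-xa (u≈0⇒-xu≈0 a≈0) , trans d≈-xb (u≈0⇒-xu≈0 b≈0)))

    left-annihilated : ∀ {B} → NontrivialIdempotent B → (B · lowerIdempotent x) ≈M 𝟎 →
                       ∃ λ t → leftAnnihilator t ≈M B
    left-annihilated {mat a b c d} ((aa+bc≈a , _ , ca+dc≈c , _) , B≉0 , _) (_ , a0+b1≈0 , _ , c0+d1≈0) =
      Sum.[ (λ a≈0 → ⊥-elim (B≉0 (a≈0 , b≈0 , trans (sym ca≈c) (trans (*-congˡ a≈0) (zeroʳ c)) , d≈0))) ,
            (λ a≈1 → c , sym a≈1 , sym b≈0 , refl , sym d≈0) ] (x*y≈x⇒x≈0∨y≈1 aa≈a)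
      where
      b≈0 = trans (solve 2 (λ a b → b := a :* O :+ b :* I) _ (a ∷ b ∷ [])) a0+b1≈0
      d≈0 = trans (solve 2 (λ c d → d := c :* O :+ d :* I) _ (c ∷ d ∷ [])) c0+d1≈0
      aa≈a : a * a ≈ a
      aa≈a = trans (solve 2 (λ a c → a :* a := a :* a :+ O :* c) _ (a ∷ c ∷ []))
                   (trans (+-congˡ (*-congʳ (sym b≈0))) aa+bc≈a)
      ca≈c : c * a ≈ c
      ca≈c = trans (solve 2 (λ a c → c :* a := c :* a :+ O :* c) _ (a ∷ c ∷ []))
                   (trans (+-congˡ (*-congʳ (sym d≈0))) ca+dc≈c)

    X-meets-Y : ∀ {s t} → rightAnnihilator x s ≈M leftAnnihilator t → t ≈ - x
    X-meets-Y {s} {t} (_ , s≈0 , -x[1+xs]≈t , _) = begin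
      t                            ≈⟨ -x[1+xs]≈t ⟨
      - (x * (1# + x * s))         ≈⟨ -‿cong (*-congˡ (+-congˡ (*-congˡ s≈0))) ⟩
      - (x * (1# + x * 0#))        ≈⟨ solve 1 (λ x → :- (x :* (I :+ x :* O)) := :- x) _ (x ∷ []) ⟩
      - x                          ∎

    neighbours-covered : ∀ (B : Neighbour (lowerIdempotent x)) →
      (∃ λ q → rightAnnihilator x q ≈M proj₁ B) ⊎ (∃ λ t → leftAnnihilator t ≈M proj₁ B)
    neighbours-covered (_ , idempotent , _ , inj₁ AB≈0) = inj₁ (right-annihilated idempotent AB≈0)
    neighbours-covered (_ , idempotent , _ , inj₂ BA≈0) = inj₂ (left-annihilated idempotent BA≈0)

    open UnionOfTwoCopies {S = setoid} {T = neighbour-setoid (lowerIdempotent x)} X Y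
      (λ s≈t → +-congˡ (*-congˡ s≈t) , s≈t , -‿cong (*-congˡ (+-congˡ (*-congˡ s≈t))) , -‿cong (*-congˡ s≈t))
      (λ s≈t → refl , refl , s≈t , refl)
      (λ Xs≈Xt → proj₁ (proj₂ Xs≈Xt))
      (λ Ys≈Yt → proj₁ (proj₂ (proj₂ Ys≈Yt)))
      0# (- x)
      (solveM 1 (λ x → leftAnnihilatorᴾ (:- x) , rightAnnihilatorᴾ x O) _ (x ∷ []))
      X-meets-Y neighbours-covered

    degree : HasDegree (lowerIdempotent x) (2 ℕ.* size ℕ.∸ 1)
    degree = enumeration-∪ (enum , enum-inj , enum-sur)

open import Data.Nat using (_*_; _∸_)

corollary3p4 : ∀ {c ℓ} (F : FiniteField c ℓ) → let open Matrices F in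
    ∀ (A : M₂) → InP A → HasDegree A (2 * FiniteField.size F ∸ 1)
corollary3p4 F = degree-in-P
  where
  open FiniteField F using (size; 0#)
  open Matrices F
  open IdempotentGraph F
  open LowerIdempotent using (degree)

  degree-in-P : ∀ A → InP A → HasDegree A (2 * size ∸ 1)
  degree-in-P A (inj₁ (lift e)) =
    HasDegree-resp (≈M-sym e) (HasDegree-rotate (degree 0#))
  degree-in-P A (inj₂ (inj₁ (lift e))) =
    HasDegree-resp (≈M-sym e) (degree 0#)
  degree-in-P A (inj₂ (inj₂ (inj₁ (x , _ , e)))) =
    HasDegree-resp (≈M-sym e) (degree x)
  degree-in-P A (inj₂ (inj₂ (inj₂ (inj₁ (b , _ , e))))) =
    HasDegree-resp (≈M-sym e) (HasDegree-transpose (degree b))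
  degree-in-P A (inj₂ (inj₂ (inj₂ (inj₂ (inj₁ (x , _ , e)))))) =
    HasDegree-resp (≈M-sym e) (HasDegree-rotate (HasDegree-transpose (degree x)))
  degree-in-P A (inj₂ (inj₂ (inj₂ (inj₂ (inj₂ (b , _ , e)))))) =
    HasDegree-resp (≈M-sym e) (HasDegree-rotate (degree b))
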